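{- Let $\mathcal{A}$ be a non-empty finite set of agents and $\mathcal{P}$ a non-empty countable set of propositional atoms, and let $\tau$ be the translation (for the class $\mathcal{K}45$) from action formulae to multi-pointed action models described in the context. Then for every action formula $\alpha$, every accessibility relation of the action model $\tau(\alpha)$ is transitive and Euclidean, i.e. $\tau(\alpha)$ belongs to the class $\mathcal{AM}_{\mathcal{K}45}$ of transitive–Euclidean action models.
   Context: An action model is $\mathsf{M}=(\mathsf{S},\to,\mathsf{pre})$ where $\mathsf{S}$ is a non-empty finite set of action points, $\to$ assigns to each agent $a\in\mathcal{A}$ a relation $\to_a\subseteq \mathsf{S}\times\mathsf{S}$, and $\mathsf{pre}$ assigns a formula (precondition) to each action point. A multi-pointed action model is a pair $(\mathsf{M},\mathsf{T})$ with $\mathsf{T}\subseteq\mathsf{S}$. For $t\in\mathsf{S}$ write $t\to_a=\{u\mid t\to_a u\}$. $\mathcal{AM}_{\mathcal{K}45}$ is the class of action models all of whose relations $\to_a$ are transitive and Euclidean. Action formulae are generated (mutually with formulae) by $\varphi ::= p \mid \neg\varphi \mid (\varphi\wedge\varphi) \mid \Box_a\varphi \mid [\alpha]\varphi$ and $\alpha ::= ?\varphi \mid \alpha\cup\alpha \mid \alpha;\alpha \mid L_B(\alpha,\alpha)$, where $p\in\mathcal{P}$, $a\in\mathcal{A}$, $\emptyset\neq B\subseteq\mathcal{A}$. Sequential composition of multi-pointed action models: $(\mathsf{M},\mathsf{T})\otimes(\mathsf{M}',\mathsf{T}')$ has domain $\mathsf{S}\times\mathsf{S}'$, $(e,e')\to_a(f,f')$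 iff $e\to_a f$ and $e'\to'_a f'$, precondition $\mathsf{pre}((e,e'))=\langle \mathsf{M},e\rangle \mathsf{pre}'(e')$ (the dual of the action model modality), and designated set $\mathsf{T}\times\mathsf{T}'$. The translation $\tau$ (for $\mathcal{K}45$) is defined inductively: - $\tau(?\varphi)$: points $\{t,s\}$; for every agent $a$, $\to_a=\{(t,s),(s,s)\}$; $\mathsf{pre}(t)=\varphi$, $\mathsf{pre}(s)=\top$; designated set $\{t\}$. - $\tau(\alpha\cup\beta)$: the disjoint union of $\tau(\alpha)$ and $\tau(\beta)$ (union of domains, relations, preconditions, and designated sets, after making the domains disjoint). - $\tau(\alpha;\beta)=\tau(\alpha)\otimes\tau(\beta)$. - $\tau(L_B(\alpha,\alpha))$: let $\tau(\alpha)=((\mathsf{S}^\alpha,\to^\alpha,\mathsf{pre}^\alpha),\mathsf{T}^\alpha)$; take new points $t,s$ and, for each $u\in\mathsf{T}^\alpha$, a new "proxy" point $\hat u$. The domain is $\mathsf{S}^\alpha\cup\{t,s\}\cup\{\hat u\mid u\in\mathsf{T}^\alpha\}$; for $a\in B$: $\to_a=\to^\alpha_a\cup\{(s,s)\}\cup\{(t,\hat u)\mid u\in\mathsf{T}^\alpha\}\cup\{(\hat u,\hat v)\mid u,v\in\mathsf{T}^\alpha\}$; for $a\notin B$: $\to_a=\to^\alpha_a\cup\{(t,s),(s,s)\}\cup\{(\hat u,v)\mid u\in\mathsf{T}^\alpha, v\in u\to^\alpha_a\}$; $\mathsf{pre}$ extends $\mathsf{pre}^\alpha$ by $\mathsf{pre}(t)=\mathsf{pre}(s)=\top$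 and $\mathsf{pre}(\hat u)=\mathsf{pre}^\alpha(u)$; designated set $\{t\}$. - $\tau(L_B(\alpha,\beta))=\tau(L_B(\alpha\cup\beta,\alpha\cup\beta))$. -}

module Defs where

open import Data.Nat using (ℕ; zero; suc; _+_; _*_)
open import Data.Fin using (Fin; zero; suc; splitAt; remQuot; _≟_)
open import Data.Fin.Subset using (Subset; Nonempty)
open import Data.Bool using (Bool; true; false; _∧_; if_then_else_; T)
open import Data.Vec using (lookup)
open import Data.Sum using (_⊎_; inj₁; inj₂)
open import Data.Product using (Σ; _×_; _,_; proj₁; proj₂)
open import Relation.Nullary.Decidable using (⌊_⌋)
open import Relation.Binary.PropositionalEquality using (_≡_; _≢_)

-- Syntax and the translation τ, parametrised by:
--   nA  : agents are  Fin (suc nA)  (a non-empty finite set),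
--   Atom: the set of propositional atoms, with a distinguished atom p₀
--         (non-emptiness; used only to define ⊤ := ¬(p₀ ∧ ¬p₀)).
module Syntax (nA : ℕ) (Atom : Set) (p₀ : Atom) where

  Agent : Set
  Agent = Fin (suc nA)

  mutual
    -- formulae: p | ¬φ | φ∧φ | □ₐφ | [α]φ, together with the action model
    -- modality [M,T]φ (needed for the preconditions ⟨M,e⟩pre'(e') in ⊗)
    data Form : Set where
      atom  : Atom → Form
      neg   : Form → Form
      conj  : Form → Form → Form
      box   : Agent → Form → Form
      actBox : Act → Form → Form
      amBox : MAM → Form → Form

    data Act : Set where
      test : Form → Act
      cup  : Act → Act → Act
      seq  : Act → Act → Act
      L    : (B : Subset (suc nA)) → Nonempty B → Act → Act → Act

    record AM : Set where
      inductive
      field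
        k   : ℕ
        rel : Agent → Fin (suc k) → Fin (suc k) → Bool
        pre : Fin (suc k) → Form

    -- multi-pointed action model (M , T), T ⊆ S given by its characteristic function
    MAM : Set
    MAM = Σ AM (λ M → Fin (suc (AM.k M)) → Bool)

  open AM public

  Point : AM → Set
  Point M = Fin (suc (k M))

  ⊤f : Form
  ⊤f = neg (conj (atom p₀) (neg (atom p₀)))

  diamond : (M : AM) → Point M → Form → Form
  diamond M e φ = neg (amBox (M , λ f → ⌊ f ≟ e ⌋) (neg φ))

  Transitive : (M : AM) → Set
  Transitive M = ∀ (a : Agent) (x y z : Point M) →
    T (rel M a x y) → T (rel M a y z) → T (rel M a x z)

  Euclidean : (M : AM) → Set
  Euclidean M = ∀ (a : Agent) (x y z : Point M) →
    T (rel M a x y) → T (rel M a x z) → T (rel M a y z)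

  K45 : AM → Set
  K45 M = Transitive M × Euclidean M

  -- τ(?φ): points t = 0, s = 1; →ₐ = {(t,s),(s,s)}; designated {t}
  testAM : Form → MAM
  testAM φ = record { k = 1 ; rel = r ; pre = p } , des
    where
      r : Agent → Fin 2 → Fin 2 → Bool
      r a _ zero = false
      r a _ (suc zero) = true
      p : Fin 2 → Form
      p zero = φ
      p (suc zero) = ⊤f
      des : Fin 2 → Bool
      des zero = true
      des (suc zero) = false

  unionAM : MAM → MAM → MAM
  unionAM (M , TM) (N , TN) =
    record { k = k M + suc (k N) ; rel = r ; pre = p } , des
    where
      r : Agent → Fin (suc (k M) + suc (k N)) → Fin (suc (k M) + suc (k N)) → Bool
      r a x y with splitAt (suc (k M)) x | splitAt (suc (k M)) y
      ... | inj₁ x' | inj₁ y' = rel M a x' y'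
      ... | inj₂ x' | inj₂ y' = rel N a x' y'
      ... | inj₁ _  | inj₂ _  = false
      ... | inj₂ _  | inj₁ _  = false
      p : Fin (suc (k M) + suc (k N)) → Form
      p x with splitAt (suc (k M)) x
      ... | inj₁ x' = pre M x'
      ... | inj₂ x' = pre N x'
      des : Fin (suc (k M) + suc (k N)) → Bool
      des x with splitAt (suc (k M)) x
      ... | inj₁ x' = TM x'
      ... | inj₂ x' = TN x'

  -- sequential composition ⊗: domain S × S' encoded as Fin (suc k₁ * suc k₂)
  compAM : MAM → MAM → MAM
  compAM (M , TM) (N , TN) =
    record { k = k N + k M * suc (k N) ; rel = r ; pre = p } , des
    where
      r : Agent → Fin (suc (k M) * suc (k N)) → Fin (suc (k M) * suc (k N)) → Bool
      r a x y with remQuot (suc (k N)) x | remQuot (suc (k N)) y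
      ... | (e , e') | (f , f') = rel M a e f ∧ rel N a e' f'
      p : Fin (suc (k M) * suc (k N)) → Form
      p x with remQuot (suc (k N)) x
      ... | (e , e') = diamond M e (pre N e')
      des : Fin (suc (k M) * suc (k N)) → Bool
      des x with remQuot (suc (k N)) x
      ... | (e , e') = TM e ∧ TN e'

  count : ∀ {n} → (Fin n → Bool) → ℕ
  count {zero} D = zero
  count {suc n} D with D zero
  ... | true  = suc (count (λ i → D (suc i)))
  ... | false = count (λ i → D (suc i))

  emb : ∀ {n} (D : Fin n → Bool) → Fin (count D) → Fin n
  emb {suc n} D i with D zero
  emb {suc n} D zero    | true = zero
  emb {suc n} D (suc i) | true = suc (emb (λ j → D (suc j)) i)
  ... | false = suc (emb (λ j → D (suc j)) i)

  -- τ(L_B(α,α)) from (M,T) = τ(α): domain S ∪ {t,s} ∪ {û | u ∈ T},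
  -- encoded as Fin (suc k + (2 + count T)): first S, then t, s, then proxies
  data View (n m : ℕ) : Set where
    old   : Fin n → View n m
    tpt   : View n m
    spt   : View n m
    proxy : Fin m → View n m

  view : ∀ n m → Fin (n + (2 + m)) → View n m
  view n m x with splitAt n x
  ... | inj₁ u = old u
  ... | inj₂ zero = tpt
  ... | inj₂ (suc zero) = spt
  ... | inj₂ (suc (suc j)) = proxy j

  lbAM : Subset (suc nA) → MAM → MAM
  lbAM B (M , TM) =
    record { k = k M + (2 + count TM) ; rel = r ; pre = p } , des
    where
      n m : ℕ
      n = suc (k M)
      m = count TM
      r' : Agent → Bool → View n m → View n m → Bool
      r' a _     (old u)   (old v)   = rel M a u v
      r' a _     spt       spt       = true
      r' a true  tpt       (proxy _) = true
      r' a true  (proxy _) (proxy _) = true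
      r' a false tpt       spt       = true
      r' a false (proxy j) (old v)   = rel M a (emb TM j) v
      r' a _     _         _         = false
      r : Agent → Fin (n + (2 + m)) → Fin (n + (2 + m)) → Bool
      r a x y = r' a (lookup B a) (view n m x) (view n m y)
      p' : View n m → Form
      p' (old u)   = pre M u
      p' tpt       = ⊤f
      p' spt       = ⊤f
      p' (proxy j) = pre M (emb TM j)
      p : Fin (n + (2 + m)) → Form
      p x = p' (view n m x)
      d' : View n m → Bool
      d' tpt = true
      d' _   = false
      des : Fin (n + (2 + m)) → Bool
      des x = d' (view n m x)

  -- the translation τ, as its graph: Tau α Mα  means  τ(α) = Mα.
  -- (A graph is used because the L-clause distinguishes α = β from α ≠ β,
  -- and equality of action formulae is not decidable constructively here.)
  data Tau : Act → MAM → Set where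
    τ-test : ∀ φ → Tau (test φ) (testAM φ)
    τ-cup  : ∀ {α β M N} → Tau α M → Tau β N → Tau (cup α β) (unionAM M N)
    τ-seq  : ∀ {α β M N} → Tau α M → Tau β N → Tau (seq α β) (compAM M N)
    τ-L=   : ∀ {B ne α M} → Tau α M → Tau (L B ne α α) (lbAM B M)
    τ-L≠   : ∀ {B ne α β M} → α ≢ β → Tau (cup α β) M → Tau (L B ne α β) (lbAM B M)

-- Every construction used by τ preserves transitivity and Euclideanity of
-- each →ₐ, so the claim follows by induction on the derivation of τ(α).
-- Tests, unions and products are immediate.  For L_B the new part of the
-- model is a small gadget: for a ∈ B the proxies form a single cluster
-- reached from t, and for a ∉ B each proxy û has exactly the successors of
-- u, so chains and forks through û are chains and forks through u.
module Submission where

open import Defs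
open import Data.Nat using (ℕ; suc)
open import Data.Fin using (zero; suc; splitAt)
open import Data.Fin.Subset using (Subset)
open import Data.Vec using (lookup)
open import Data.Bool using (Bool; true; false; T)
open import Data.Bool.Properties using (T-∧)
open import Data.Unit using (tt)
open import Data.Sum using (inj₁; inj₂)
open import Data.Product using (proj₁; _,_)
open import Function.Bundles using (Equivalence)
open import Function.Definitions using (Injective)
open import Relation.Binary.PropositionalEquality using (_≡_)

module K45-Closure (nA : ℕ) (Atom : Set) (p₀ : Atom) where
  open Syntax nA Atom p₀
  open Equivalence

  testAM-K45 : ∀ φ → K45 (proj₁ (testAM φ))
  testAM-K45 φ = (λ { _ _ _ (suc zero) _ _ → tt }) , (λ { _ _ _ (suc zero) _ _ → tt })

  unionAM-K45 : ∀ M N → K45 (proj₁ M) → K45 (proj₁ N) → K45 (proj₁ (unionAM M N))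
  unionAM-K45 (M , D) (N , E) (transM , euclM) (transN , euclN) = trans , eucl
    where
      -- Mixed cases are omitted: there the hypothesis has type T false = ⊥.
      trans : Transitive (proj₁ (unionAM (M , D) (N , E)))
      trans a x y z xy yz
        with splitAt (suc (k M)) x | splitAt (suc (k M)) y | splitAt (suc (k M)) z
      ... | inj₁ x′ | inj₁ y′ | inj₁ z′ = transM a x′ y′ z′ xy yz
      ... | inj₂ x′ | inj₂ y′ | inj₂ z′ = transN a x′ y′ z′ xy yz
      eucl : Euclidean (proj₁ (unionAM (M , D) (N , E)))
      eucl a x y z xy xz
        with splitAt (suc (k M)) x | splitAt (suc (k M)) y | splitAt (suc (k M)) z
      ... | inj₁ x′ | inj₁ y′ | inj₁ z′ = euclM a x′ y′ z′ xy xz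
      ... | inj₂ x′ | inj₂ y′ | inj₂ z′ = euclN a x′ y′ z′ xy xz

  compAM-K45 : ∀ M N → K45 (proj₁ M) → K45 (proj₁ N) → K45 (proj₁ (compAM M N))
  compAM-K45 M N (transM , euclM) (transN , euclN) = trans , eucl
    where
      trans : Transitive (proj₁ (compAM M N))
      trans a _ _ _ xy yz with to T-∧ xy | to T-∧ yz
      ... | xy₁ , xy₂ | yz₁ , yz₂ =
        from T-∧ (transM a _ _ _ xy₁ yz₁ , transN a _ _ _ xy₂ yz₂)
      eucl : Euclidean (proj₁ (compAM M N))
      eucl a _ _ _ xy xz with to T-∧ xy | to T-∧ xz
      ... | xy₁ , xy₂ | xz₁ , xz₂ =
        from T-∧ (euclM a _ _ _ xy₁ xz₁ , euclN a _ _ _ xy₂ xz₂)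

  module _ (B : Subset (suc nA)) (M : AM) (D : Point M → Bool) (a : Agent) where

    private
      n m : ℕ
      n = suc (k M)
      m = count D

    -- The edges of →ₐ in τ(L_B(α,α)); the index records whether a ∈ B.
    data Edge : Bool → View n m → View n m → Set where
      old→old     : ∀ {b u v} → T (rel M a u v) → Edge b (old u) (old v)
      s→s         : ∀ {b} → Edge b spt spt
      t→proxy     : ∀ {j} → Edge true tpt (proxy j)
      proxy→proxy : ∀ {i j} → Edge true (proxy i) (proxy j)
      t→s         : Edge false tpt spt
      proxy→old   : ∀ {i v} → T (rel M a (emb D i) v) → Edge false (proxy i) (old v)

    edge-trans : ∀ {b x y z} → (∀ u v w → T (rel M a u v) → T (rel M a v w) → T (rel M a u w)) →
      Edge b x y → Edge b y z → Edge b x z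
    edge-trans transM (old→old uv)   (old→old vw) = old→old (transM _ _ _ uv vw)
    edge-trans transM s→s            s→s          = s→s
    edge-trans transM t→proxy        proxy→proxy  = t→proxy
    edge-trans transM proxy→proxy    proxy→proxy  = proxy→proxy
    edge-trans transM t→s            s→s          = t→s
    edge-trans transM (proxy→old uv) (old→old vw) = proxy→old (transM _ _ _ uv vw)

    edge-eucl : ∀ {b x y z} → (∀ u v w → T (rel M a u v) → T (rel M a u w) → T (rel M a v w)) →
      Edge b x y → Edge b x z → Edge b y z
    edge-eucl euclM (old→old uv)   (old→old uw)   = old→old (euclM _ _ _ uv uw)
    edge-eucl euclM s→s            s→s            = s→s
    edge-eucl euclM t→proxy        t→proxy        = proxy→proxy
    edge-eucl euclM proxy→proxy    proxy→proxy    = proxy→proxy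
    edge-eucl euclM t→s            t→s            = s→s
    edge-eucl euclM (proxy→old uv) (proxy→old uw) = old→old (euclM _ _ _ uv uw)

    rel-lbAM⇒Edge : ∀ x y → T (rel (proj₁ (lbAM B (M , D))) a x y) →
      Edge (lookup B a) (view n m x) (view n m y)
    rel-lbAM⇒Edge x y xy with lookup B a | view n m x | view n m y
    ... | _     | old _   | old _   = old→old xy
    ... | _     | spt     | spt     = s→s
    ... | true  | tpt     | proxy _ = t→proxy
    ... | true  | proxy _ | proxy _ = proxy→proxy
    ... | false | tpt     | spt     = t→s
    ... | false | proxy _ | old _   = proxy→old xy

    Edge⇒rel-lbAM : ∀ x y → Edge (lookup B a) (view n m x) (view n m y) →
      T (rel (proj₁ (lbAM B (M , D))) a x y)
    Edge⇒rel-lbAM x y xy with lookup B a | view n m x | view n m y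
    Edge⇒rel-lbAM x y (old→old uv)   | _ | _ | _ = uv
    Edge⇒rel-lbAM x y s→s            | _ | _ | _ = tt
    Edge⇒rel-lbAM x y t→proxy        | _ | _ | _ = tt
    Edge⇒rel-lbAM x y proxy→proxy    | _ | _ | _ = tt
    Edge⇒rel-lbAM x y t→s            | _ | _ | _ = tt
    Edge⇒rel-lbAM x y (proxy→old uv) | _ | _ | _ = uv

  lbAM-K45 : ∀ B M → K45 (proj₁ M) → K45 (proj₁ (lbAM B M))
  lbAM-K45 B (M , D) (transM , euclM) = trans , eucl
    where
      trans : Transitive (proj₁ (lbAM B (M , D)))
      trans a x y z xy yz = Edge⇒rel-lbAM B M D a x z
        (edge-trans B M D a (transM a) (rel-lbAM⇒Edge B M D a x y xy) (rel-lbAM⇒Edge B M D a y z yz))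
      eucl : Euclidean (proj₁ (lbAM B (M , D)))
      eucl a x y z xy xz = Edge⇒rel-lbAM B M D a y z
        (edge-eucl B M D a (euclM a) (rel-lbAM⇒Edge B M D a x y xy) (rel-lbAM⇒Edge B M D a x z xz))

  Tau⇒K45 : ∀ {α Mα} → Tau α Mα → K45 (proj₁ Mα)
  Tau⇒K45 (τ-test φ)                     = testAM-K45 φ
  Tau⇒K45 (τ-cup {M = M} {N} τα τβ)      = unionAM-K45 M N (Tau⇒K45 τα) (Tau⇒K45 τβ)
  Tau⇒K45 (τ-seq {M = M} {N} τα τβ)      = compAM-K45 M N (Tau⇒K45 τα) (Tau⇒K45 τβ)
  Tau⇒K45 (τ-L= {B = B} {M = M} τα)      = lbAM-K45 B M (Tau⇒K45 τα)
  Tau⇒K45 (τ-L≠ {B = B} {M = M} _ τα∪β) = lbAM-K45 B M (Tau⇒K45 τα∪β)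

lemma4p10 : (nA : ℕ) (Atom : Set) (p₀ : Atom) (enc : Atom → ℕ) → Injective _≡_ _≡_ enc →
    (α : Syntax.Act nA Atom p₀) (Mα : Syntax.MAM nA Atom p₀) →
    Syntax.Tau nA Atom p₀ α Mα → Syntax.K45 nA Atom p₀ (proj₁ Mα)
lemma4p10 nA Atom p₀ _ _ _ _ = K45-Closure.Tau⇒K45 nA Atom p₀
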